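{- Let $M \geq 1$ be an integer and let $y_1, \dots, y_M$ be non-negative real numbers with $\sum_{m=1}^M y_m = N$. Extend $(y_m)$ periodically by $y_m = y_{m'}$ whenever $m \equiv m' \pmod M$, $m' \in \{1,\dots,M\}$, $m \in \mathbb{Z}$. For integers $s \geq 1$ define $$H_{N,M}(s) = \sum_{m=1}^M \sum_{\ell=-s+1}^{s-1} y_m y_{m+\ell}.$$ Let $S \geq 1$ be an integer with $2S < M$. Then $$\frac{1}{S} \sum_{s=1}^S H_{N,M}(s) \geq \frac{S N^2}{M}.$$ -}

module Defs where

open import Level using (Level; _⊔_) renaming (suc to lsuc)
open import Data.Nat as ℕ using (ℕ; zero; suc; NonZero)
open import Data.Integer as ℤ using (ℤ; _%ℕ_)
open import Data.Nat.DivMod using (_mod_)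
open import Data.Fin as Fin using (Fin)
import Data.Fin
import Data.Sum
open import Data.Product using (Σ; _×_; ∃)
open import Relation.Nullary using (¬_)
open import Relation.Binary using (Rel)
open import Algebra.Bundles using (CommutativeRing)

-- An axiomatisation of the real numbers: a Dedekind-complete ordered field.
-- (Any model is isomorphic to ℝ.)  Equality is the setoid equality _≈_.
record RealField (c ℓ ℓ' : Level) : Set (lsuc (c ⊔ ℓ ⊔ ℓ')) where
  field
    commRing : CommutativeRing c ℓ
  open CommutativeRing commRing public
  field
    _≤_        : Rel Carrier ℓ'
    _⁻¹        : Carrier → Carrier
    ⁻¹-inverse : ∀ x → ¬ (x ≈ 0#) → (x * x ⁻¹) ≈ 1#
    0≉1        : ¬ (0# ≈ 1#)
    ≤-resp-≈   : ∀ {x x' y y'} → x ≈ x' → y ≈ y' → x ≤ y → x' ≤ y'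
    ≤-refl     : ∀ {x} → x ≤ x
    ≤-trans    : ∀ {x y z} → x ≤ y → y ≤ z → x ≤ z
    ≤-antisym  : ∀ {x y} → x ≤ y → y ≤ x → x ≈ y
    ≤-total    : ∀ x y → (x ≤ y) Data.Sum.⊎ (y ≤ x)
    +-mono-≤   : ∀ {x y} z → x ≤ y → (x + z) ≤ (y + z)
    *-nonneg   : ∀ {x y} → 0# ≤ x → 0# ≤ y → 0# ≤ (x * y)
    sup        : ∀ (P : Carrier → Set c) → ∃ P → (Σ Carrier λ b → ∀ x → P x → x ≤ b) →
                 Σ Carrier λ u → (∀ x → P x → x ≤ u) × (∀ b → (∀ x → P x → x ≤ b) → u ≤ b)
  fromℕ : ℕ → Carrier
  fromℕ zero    = 0#
  fromℕ (suc n) = 1# + fromℕ n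

  sumFin : ∀ n → (Fin n → Carrier) → Carrier
  sumFin zero    f = 0#
  sumFin (suc n) f = f Fin.zero + sumFin n (λ i → f (Fin.suc i))

  sumℤRange : ℤ → ℕ → (ℤ → Carrier) → Carrier
  sumℤRange a zero      f = 0#
  sumℤRange a (suc len) f = f a + sumℤRange (a ℤ.+ ℤ.+ 1) len f

  sumFrom1 : ℕ → (ℕ → Carrier) → Carrier
  sumFrom1 zero    f = 0#
  sumFrom1 (suc S) f = sumFrom1 S f + f (suc S)

  -- periodic extension of y : Fin M → ℝ to ℤ (indices taken modulo M, 0-based)
  yper : ∀ M .{{_ : NonZero M}} → (Fin M → Carrier) → ℤ → Carrier
  yper M y k = y ((k %ℕ M) mod M)

  H : ∀ M .{{_ : NonZero M}} → (Fin M → Carrier) → ℕ → Carrier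
  H M y s = sumFin M λ m →
              sumℤRange (ℤ.- (ℤ.+ s) ℤ.+ ℤ.+ 1) (s ℕ.+ s ℕ.∸ 1) λ ℓ →
                y m * yper M y (ℤ.+ (Data.Fin.toℕ m) ℤ.+ ℓ)

module Submission where

-- Write f for the M-periodic extension of y and, for t ≥ 0,
--   W_t(k) = f(k) + f(k+1) + … + f(k+t-1)
-- for the sliding window sum of length t.  Summing over one period,
--   (1) Σ_k W_t(k) = t·N, since each f(j) occurs in exactly t windows;
--   (2) Σ_{s=1}^{t} H(s) = Σ_k W_t(k)², the "energy identity": expanding
--       W_{t+1}(k) = f(k) + W_t(k+1) shows that the energy grows by exactly
--       H(t+1) when the window is lengthened, thanks to the symmetry
--       Σ_k f(k)·W_t(k-t) = Σ_k f(k)·W_t(k+1) of the correlation.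
-- The quadratic-mean inequality (Σ_{k<M} w_k)² / M ≤ Σ_{k<M} w_k² (a sum form
-- of Cauchy–Schwarz, derived from 2ab ≤ a² + b²) applied to w = W_S then gives
-- Σ_{s=1}^{S} H(s) ≥ (S·N)²/M, and dividing by S is the theorem.

open import Defs
open import Data.Nat as ℕ using (ℕ; zero; suc; NonZero)
open import Data.Fin using (Fin)
open import Data.Integer as ℤ using (ℤ; +_; -[1+_]; ∣_∣; _%ℕ_; _/ℕ_)
import Data.Nat.Properties as ℕP
import Data.Integer.Properties as ℤP
import Data.Fin.Properties as FinP
open import Data.Nat.DivMod using (_mod_; m<n⇒m%n≡m; m%n%n≡m%n; [m+kn]%n≡m%n)
open import Data.Integer.DivMod using (a≡a%ℕn+[a/ℕn]*n; n%ℕd<d)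
open import Data.Integer.Tactic.RingSolver using (solve-∀)
open import Data.Product using (Σ; _,_; proj₁)
open import Data.Sum using (inj₁; inj₂)
open import Data.Maybe using (nothing)
open import Data.Empty using (⊥-elim)
open import Relation.Nullary using (¬_)
import Relation.Binary.PropositionalEquality as Eq
import Tactic.RingSolver.Core.AlmostCommutativeRing as ACR
import Algebra.Solver.CommutativeMonoid as CommutativeMonoidSolver

module IntegerResidues where
  open Eq using (_≡_; refl; sym; trans; cong)
  open Eq.≡-Reasoning

  shift-to-ℕ : ∀ q c → ∣ q ∣ ℕ.≤ c → Σ ℕ λ Q → + Q ≡ q ℤ.+ + c
  shift-to-ℕ (+ n)    c _ = n ℕ.+ c , refl
  shift-to-ℕ -[1+ n ] c p = c ℕ.∸ suc n , sym (ℤP.⊖-≥ p)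

  -- Adding c·d to both sides makes the quotients natural,
  -- after which reduction modulo d in ℕ recovers the remainders.
  remainder-unique : ∀ r r' q q' d .{{_ : NonZero d}} → r ℕ.< d → r' ℕ.< d →
                     + r ℤ.+ q ℤ.* + d ≡ + r' ℤ.+ q' ℤ.* + d → r ≡ r'
  remainder-unique r r' q q' d r<d r'<d eq = begin
    r                       ≡⟨ sym (m<n⇒m%n≡m r<d) ⟩
    r ℕ.% d                 ≡⟨ sym ([m+kn]%n≡m%n r Q d) ⟩
    (r ℕ.+ Q ℕ.* d) ℕ.% d   ≡⟨ cong (ℕ._% d) (ℤP.+-injective shifted) ⟩
    (r' ℕ.+ Q' ℕ.* d) ℕ.% d ≡⟨ [m+kn]%n≡m%n r' Q' d ⟩
    r' ℕ.% d                ≡⟨ m<n⇒m%n≡m r'<d ⟩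
    r'                      ∎
    where
    c = ∣ q ∣ ℕ.+ ∣ q' ∣
    Q  = proj₁ (shift-to-ℕ q  c (ℕP.m≤m+n ∣ q ∣ ∣ q' ∣))
    Q' = proj₁ (shift-to-ℕ q' c (ℕP.m≤n+m ∣ q' ∣ ∣ q ∣))

    add-multiple : ∀ (x q c d : ℤ) → (x ℤ.+ q ℤ.* d) ℤ.+ c ℤ.* d ≡ x ℤ.+ (q ℤ.+ c) ℤ.* d
    add-multiple = solve-∀

    as-shift : ∀ r q → (sh : Σ ℕ λ Q → + Q ≡ q ℤ.+ + c) →
               + (r ℕ.+ proj₁ sh ℕ.* d) ≡ (+ r ℤ.+ q ℤ.* + d) ℤ.+ + c ℤ.* + d
    as-shift r q (Q , Q≡q+c) = begin
      + r ℤ.+ + (Q ℕ.* d)          ≡⟨ cong (λ z → + r ℤ.+ z) (ℤP.pos-* Q d) ⟩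
      + r ℤ.+ + Q ℤ.* + d          ≡⟨ cong (λ z → + r ℤ.+ z ℤ.* + d) Q≡q+c ⟩
      + r ℤ.+ (q ℤ.+ + c) ℤ.* + d  ≡⟨ sym (add-multiple (+ r) q (+ c) (+ d)) ⟩
      (+ r ℤ.+ q ℤ.* + d) ℤ.+ + c ℤ.* + d ∎

    shifted : + (r ℕ.+ Q ℕ.* d) ≡ + (r' ℕ.+ Q' ℕ.* d)
    shifted = begin
      + (r ℕ.+ Q ℕ.* d)                     ≡⟨ as-shift r q (shift-to-ℕ q c _) ⟩
      (+ r ℤ.+ q ℤ.* + d) ℤ.+ + c ℤ.* + d   ≡⟨ cong (ℤ._+ + c ℤ.* + d) eq ⟩
      (+ r' ℤ.+ q' ℤ.* + d) ℤ.+ + c ℤ.* + d ≡⟨ sym (as-shift r' q' (shift-to-ℕ q' c _)) ⟩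
      + (r' ℕ.+ Q' ℕ.* d)                   ∎

  -- k + d = (k %ℕ d) + (k /ℕ d + 1)·d, so k + d has the same remainder as k.
  %ℕ-periodic : ∀ k d .{{_ : NonZero d}} → (k ℤ.+ + d) %ℕ d ≡ k %ℕ d
  %ℕ-periodic k d = sym (remainder-unique (k %ℕ d) ((k ℤ.+ + d) %ℕ d)
    (k /ℕ d ℤ.+ + 1) ((k ℤ.+ + d) /ℕ d) d (n%ℕd<d k d) (n%ℕd<d (k ℤ.+ + d) d)
    (trans (sym (next-quotient k (+ (k %ℕ d)) (k /ℕ d) (+ d) (a≡a%ℕn+[a/ℕn]*n k d))) (a≡a%ℕn+[a/ℕn]*n (k ℤ.+ + d) d)))
    where
    next-quotient : ∀ (k r q d : ℤ) → k ≡ r ℤ.+ q ℤ.* d → k ℤ.+ d ≡ r ℤ.+ (q ℤ.+ + 1) ℤ.* d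
    next-quotient _ r q d refl = identity r q d
      where
      identity : ∀ (r q d : ℤ) → (r ℤ.+ q ℤ.* d) ℤ.+ d ≡ r ℤ.+ (q ℤ.+ + 1) ℤ.* d
      identity = solve-∀

module OrderedFieldFacts {c ℓ ℓ'} (R : RealField c ℓ ℓ') where
  open RealField R
  open import Relation.Binary.Reasoning.Setoid setoid
  open import Algebra.Properties.Ring ring using (-‿distribʳ-*; -‿distribˡ-*)
  open import Algebra.Properties.AbelianGroup +-abelianGroup using (⁻¹-involutive)
  open import Tactic.RingSolver.NonReflective (ACR.fromCommutativeRing commRing (λ _ → nothing))
    using (solve; _⊕_; _⊗_)

  +-mono-≤₂ : ∀ {a b x y} → a ≤ b → x ≤ y → (a + x) ≤ (b + y)
  +-mono-≤₂ {a} {b} {x} {y} a≤b x≤y =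
    ≤-trans (+-mono-≤ x a≤b) (≤-resp-≈ (+-comm x b) (+-comm y b) (+-mono-≤ b x≤y))

  +-cancelʳ-≤ : ∀ {a b x} → (a + x) ≤ (b + x) → a ≤ b
  +-cancelʳ-≤ {a} {b} {x} p = ≤-resp-≈ (cancel a) (cancel b) (+-mono-≤ (- x) p)
    where
    cancel : ∀ z → (z + x) - x ≈ z
    cancel z = begin
      (z + x) - x   ≈⟨ +-assoc z x (- x) ⟩
      z + (x - x)   ≈⟨ +-congˡ (-‿inverseʳ x) ⟩
      z + 0#        ≈⟨ +-identityʳ z ⟩
      z             ∎

  ≤⇒0≤- : ∀ {x y} → x ≤ y → 0# ≤ (y - x)
  ≤⇒0≤- {x} p = ≤-resp-≈ (-‿inverseʳ x) refl (+-mono-≤ (- x) p)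

  0≤-⇒≤ : ∀ {x y} → 0# ≤ (y - x) → x ≤ y
  0≤-⇒≤ {x} {y} p = ≤-resp-≈ (+-identityˡ x) cancel (+-mono-≤ x p)
    where
    cancel : (y - x) + x ≈ y
    cancel = begin
      (y - x) + x     ≈⟨ +-assoc y (- x) x ⟩
      y + (- x + x)   ≈⟨ +-congˡ (-‿inverseˡ x) ⟩
      y + 0#          ≈⟨ +-identityʳ y ⟩
      y               ∎

  *-monoˡ-≤ : ∀ {a b z} → 0# ≤ z → a ≤ b → (z * a) ≤ (z * b)
  *-monoˡ-≤ {a} {b} {z} 0≤z a≤b = 0≤-⇒≤ (≤-resp-≈ refl expand (*-nonneg 0≤z (≤⇒0≤- a≤b)))
    where
    expand : z * (b - a) ≈ z * b - z * a
    expand = trans (distribˡ z b (- a)) (+-congˡ (sym (-‿distribʳ-* z a)))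

  -x*-x≈x*x : ∀ x → (- x) * (- x) ≈ x * x
  -x*-x≈x*x x = begin
    (- x) * (- x)   ≈⟨ sym (-‿distribʳ-* (- x) x) ⟩
    - ((- x) * x)   ≈⟨ -‿cong (sym (-‿distribˡ-* x x)) ⟩
    - (- (x * x))   ≈⟨ ⁻¹-involutive (x * x) ⟩
    x * x           ∎

  square-nonneg : ∀ x → 0# ≤ (x * x)
  square-nonneg x with ≤-total 0# x
  ... | inj₁ 0≤x = *-nonneg 0≤x 0≤x
  ... | inj₂ x≤0 = ≤-resp-≈ refl (-x*-x≈x*x x) (*-nonneg 0≤-x 0≤-x)
    where
    0≤-x : 0# ≤ (- x)
    0≤-x = ≤-resp-≈ refl (+-identityˡ (- x)) (≤⇒0≤- x≤0)

  0≤1 : 0# ≤ 1#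
  0≤1 = ≤-resp-≈ refl (*-identityˡ 1#) (square-nonneg 1#)

  fromℕ-nonneg : ∀ n → 0# ≤ fromℕ n
  fromℕ-nonneg zero    = ≤-refl
  fromℕ-nonneg (suc n) = ≤-resp-≈ (+-identityˡ 0#) refl (+-mono-≤₂ 0≤1 (fromℕ-nonneg n))

  fromℕ-suc≉0 : ∀ n → ¬ (fromℕ (suc n) ≈ 0#)
  fromℕ-suc≉0 n 1+n≈0 = 0≉1 (≤-antisym 0≤1 (≤-resp-≈ refl 1+n≈0 1≤1+n))
    where
    1≤1+n : 1# ≤ (1# + fromℕ n)
    1≤1+n = ≤-resp-≈ (+-identityʳ 1#) refl (+-mono-≤₂ (≤-refl {1#}) (fromℕ-nonneg n))

  -- The inverse of a positive element is nonnegative: x⁻¹ ≤ 0 would give 1 = x·x⁻¹ ≤ 0.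
  ⁻¹-nonneg : ∀ x → ¬ (x ≈ 0#) → 0# ≤ x → 0# ≤ (x ⁻¹)
  ⁻¹-nonneg x x≉0 0≤x with ≤-total 0# (x ⁻¹)
  ... | inj₁ 0≤x⁻¹ = 0≤x⁻¹
  ... | inj₂ x⁻¹≤0 = ⊥-elim (0≉1 (≤-antisym 0≤1
          (≤-resp-≈ (⁻¹-inverse x x≉0) (zeroʳ x) (*-monoˡ-≤ 0≤x x⁻¹≤0))))

  -- 2xy ≤ x² + y², from 0 ≤ (x - y)² = x² + y² - 2xy.
  2xy≤x²+y² : ∀ x y → (x * y + x * y) ≤ (x * x + y * y)
  2xy≤x²+y² x y = ≤-resp-≈ (+-identityˡ (p + p)) expand (+-mono-≤ (p + p) (square-nonneg (x - y)))
    where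
    p = x * y
    -- the solver cannot cancel p against - p, so -y is treated as a variable w
    expand : (x - y) * (x - y) + (p + p) ≈ x * x + y * y
    expand = begin
      (x - y) * (x - y) + (p + p)
        ≈⟨ solve 3 (λ x w p → (x ⊕ w) ⊗ (x ⊕ w) ⊕ (p ⊕ p) , (x ⊗ x ⊕ w ⊗ w) ⊕ ((x ⊗ w ⊕ p) ⊕ (x ⊗ w ⊕ p))) refl x (- y) p ⟩
      (x * x + (- y) * (- y)) + ((x * (- y) + p) + (x * (- y) + p))
        ≈⟨ +-cong (+-congˡ (-x*-x≈x*x y)) (+-cong x*-y+p≈0 x*-y+p≈0) ⟩
      (x * x + y * y) + (0# + 0#)
        ≈⟨ trans (+-congˡ (+-identityˡ 0#)) (+-identityʳ _) ⟩
      x * x + y * y ∎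
      where
      x*-y+p≈0 : x * (- y) + p ≈ 0#
      x*-y+p≈0 = trans (+-congʳ (sym (-‿distribʳ-* x y))) (-‿inverseˡ p)

module IntervalSums {c ℓ ℓ'} (R : RealField c ℓ ℓ') where
  open RealField R
  open OrderedFieldFacts R using (+-mono-≤₂)
  open import Relation.Binary.Reasoning.Setoid setoid
  open import Tactic.RingSolver.NonReflective (ACR.fromCommutativeRing commRing (λ _ → nothing))
    using (solve; _⊕_)

  ∑ : ℤ → ℕ → (ℤ → Carrier) → Carrier
  ∑ = sumℤRange

  cong≈ : ∀ (g : ℤ → Carrier) {a b} → a Eq.≡ b → g a ≈ g b
  cong≈ g a≡b = reflexive (Eq.cong g a≡b)

  ∑-cong-start : ∀ {a b} n (g : ℤ → Carrier) → a Eq.≡ b → ∑ a n g ≈ ∑ b n g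
  ∑-cong-start n g = cong≈ (λ a → ∑ a n g)

  ∑-cong : ∀ {g h : ℤ → Carrier} a n → (∀ x → g x ≈ h x) → ∑ a n g ≈ ∑ a n h
  ∑-cong a zero    g≈h = refl
  ∑-cong a (suc n) g≈h = +-cong (g≈h a) (∑-cong (a ℤ.+ + 1) n g≈h)

  ∑-+ : ∀ (g h : ℤ → Carrier) a n → ∑ a n (λ x → g x + h x) ≈ ∑ a n g + ∑ a n h
  ∑-+ g h a zero    = sym (+-identityˡ 0#)
  ∑-+ g h a (suc n) = begin
    (g a + h a) + ∑ (a ℤ.+ + 1) n (λ x → g x + h x)
      ≈⟨ +-congˡ (∑-+ g h (a ℤ.+ + 1) n) ⟩
    (g a + h a) + (∑ (a ℤ.+ + 1) n g + ∑ (a ℤ.+ + 1) n h)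
      ≈⟨ solve 4 (λ a b c d → (a ⊕ b) ⊕ (c ⊕ d) , (a ⊕ c) ⊕ (b ⊕ d)) refl (g a) (h a) _ _ ⟩
    (g a + ∑ (a ℤ.+ + 1) n g) + (h a + ∑ (a ℤ.+ + 1) n h) ∎

  ∑-*ˡ : ∀ (z : Carrier) (g : ℤ → Carrier) a n → ∑ a n (λ x → z * g x) ≈ z * ∑ a n g
  ∑-*ˡ z g a zero    = sym (zeroʳ z)
  ∑-*ˡ z g a (suc n) = trans (+-congˡ (∑-*ˡ z g (a ℤ.+ + 1) n)) (sym (distribˡ z _ _))

  ∑-const : ∀ (z : Carrier) a n → ∑ a n (λ _ → z) ≈ fromℕ n * z
  ∑-const z a zero    = sym (zeroˡ z)
  ∑-const z a (suc n) = begin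
    z + ∑ (a ℤ.+ + 1) n (λ _ → z)   ≈⟨ +-cong (sym (*-identityˡ z)) (∑-const z (a ℤ.+ + 1) n) ⟩
    1# * z + fromℕ n * z            ≈⟨ sym (distribʳ z 1# (fromℕ n)) ⟩
    (1# + fromℕ n) * z              ∎

  ∑-mono : ∀ (g h : ℤ → Carrier) a n → (∀ x → g x ≤ h x) → ∑ a n g ≤ ∑ a n h
  ∑-mono g h a zero    g≤h = ≤-refl
  ∑-mono g h a (suc n) g≤h = +-mono-≤₂ (g≤h a) (∑-mono g h (a ℤ.+ + 1) n g≤h)

  ∑-split : ∀ (g : ℤ → Carrier) a n m → ∑ a (n ℕ.+ m) g ≈ ∑ a n g + ∑ (a ℤ.+ + n) m g
  ∑-split g a zero    m = trans (∑-cong-start m g (Eq.sym (ℤP.+-identityʳ a))) (sym (+-identityˡ _))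
  ∑-split g a (suc n) m = begin
    g a + ∑ (a ℤ.+ + 1) (n ℕ.+ m) g
      ≈⟨ +-congˡ (∑-split g (a ℤ.+ + 1) n m) ⟩
    g a + (∑ (a ℤ.+ + 1) n g + ∑ ((a ℤ.+ + 1) ℤ.+ + n) m g)
      ≈⟨ sym (+-assoc _ _ _) ⟩
    (g a + ∑ (a ℤ.+ + 1) n g) + ∑ ((a ℤ.+ + 1) ℤ.+ + n) m g
      ≈⟨ +-congˡ (∑-cong-start m g (ℤP.+-assoc a (+ 1) (+ n))) ⟩
    (g a + ∑ (a ℤ.+ + 1) n g) + ∑ (a ℤ.+ + suc n) m g ∎

  ∑-snoc : ∀ (g : ℤ → Carrier) a n → ∑ a (suc n) g ≈ ∑ a n g + g (a ℤ.+ + n)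
  ∑-snoc g a n = begin
    ∑ a (suc n) g                            ≈⟨ reflexive (Eq.cong (λ m → ∑ a m g) (ℕP.+-comm 1 n)) ⟩
    ∑ a (n ℕ.+ 1) g                          ≈⟨ ∑-split g a n 1 ⟩
    ∑ a n g + (g (a ℤ.+ + n) + 0#)           ≈⟨ +-congˡ (+-identityʳ _) ⟩
    ∑ a n g + g (a ℤ.+ + n)                  ∎

  ∑-translate : ∀ (g : ℤ → Carrier) k a n → ∑ a n (λ l → g (k ℤ.+ l)) ≈ ∑ (k ℤ.+ a) n g
  ∑-translate g k a zero    = refl
  ∑-translate g k a (suc n) =
    +-congˡ (trans (∑-translate g k (a ℤ.+ + 1) n) (∑-cong-start n g (Eq.sym (ℤP.+-assoc k a (+ 1)))))

  sumFin-cong : ∀ n {g h : Fin n → Carrier} → (∀ i → g i ≈ h i) → sumFin n g ≈ sumFin n h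
  sumFin-cong zero    g≈h = refl
  sumFin-cong (suc n) g≈h = +-cong (g≈h Data.Fin.zero) (sumFin-cong n (λ i → g≈h (Data.Fin.suc i)))

  sumFin-as-∑ : ∀ (g : ℤ → Carrier) a n → sumFin n (λ i → g (a ℤ.+ + Data.Fin.toℕ i)) ≈ ∑ a n g
  sumFin-as-∑ g a zero    = refl
  sumFin-as-∑ g a (suc n) = +-cong (cong≈ g (ℤP.+-identityʳ a))
    (trans (sumFin-cong n (λ i → cong≈ g (Eq.sym (ℤP.+-assoc a (+ 1) (+ Data.Fin.toℕ i)))))
           (sumFin-as-∑ g (a ℤ.+ + 1) n))

  sumFrom1-cong : ∀ {g h : ℕ → Carrier} t → (∀ s → g s ≈ h s) → sumFrom1 t g ≈ sumFrom1 t h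
  sumFrom1-cong zero    g≈h = refl
  sumFrom1-cong (suc t) g≈h = +-cong (sumFrom1-cong t g≈h) (g≈h (suc t))

  -- For n-periodic g a window of n consecutive integers may start anywhere:
  -- moving it one step right trades the term g a for g (a + n) = g a.
  ∑-window-step : ∀ n (g : ℤ → Carrier) → (∀ k → g (k ℤ.+ + n) ≈ g k) →
                  ∀ a → ∑ (a ℤ.+ + 1) n g ≈ ∑ a n g
  ∑-window-step zero    g per a = refl
  ∑-window-step (suc n) g per a = begin
    ∑ (a ℤ.+ + 1) (suc n) g                          ≈⟨ ∑-snoc g (a ℤ.+ + 1) n ⟩
    ∑ (a ℤ.+ + 1) n g + g ((a ℤ.+ + 1) ℤ.+ + n)      ≈⟨ +-congˡ (trans (cong≈ g (ℤP.+-assoc a (+ 1) (+ n))) (per a)) ⟩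
    ∑ (a ℤ.+ + 1) n g + g a                          ≈⟨ +-comm _ _ ⟩
    g a + ∑ (a ℤ.+ + 1) n g                          ∎

  ∑-window-start : ∀ n (g : ℤ → Carrier) → (∀ k → g (k ℤ.+ + n) ≈ g k) →
                   ∀ a → ∑ a n g ≈ ∑ (+ 0) n g
  ∑-window-start n g per (+ m)    = from-pos m
    where
    from-pos : ∀ m → ∑ (+ m) n g ≈ ∑ (+ 0) n g
    from-pos zero    = refl
    from-pos (suc m) = trans (∑-cong-start n g (Eq.cong +_ (ℕP.+-comm 1 m)))
                             (trans (∑-window-step n g per (+ m)) (from-pos m))
  ∑-window-start n g per -[1+ m ] = from-neg m
    where
    from-neg : ∀ m → ∑ -[1+ m ] n g ≈ ∑ (+ 0) n g
    from-neg zero    = sym (∑-window-step n g per -[1+ 0 ])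
    from-neg (suc m) = trans (sym (∑-window-step n g per -[1+ suc m ])) (from-neg m)

  -- Quadratic-mean inequality (Cauchy–Schwarz against the constant 1):
  -- (Σ g)² / n ≤ Σ g² over an interval of length n ≥ 1.  With A = (Σ g)/n,
  -- summing 2·A·g ≤ A² + g² gives 2·A·Σg ≤ n·A² + Σg², i.e. A·Σg ≤ Σg².
  ∑-square-mean : ∀ (g : ℤ → Carrier) a n →
                  ((∑ a (suc n) g * ∑ a (suc n) g) * (fromℕ (suc n) ⁻¹)) ≤ ∑ a (suc n) (λ k → g k * g k)
  ∑-square-mean g a n = ≤-resp-≈ (sym (*-assoc q q i)) refl Z≤X
    where
    open OrderedFieldFacts R using (+-cancelʳ-≤; 2xy≤x²+y²; fromℕ-suc≉0)
    open CommutativeMonoidSolver *-commutativeMonoid using (_⊜_) renaming (solve to ×-solve; _⊕_ to _·_)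
    len = suc n
    q = ∑ a len g
    X = ∑ a len (λ k → g k * g k)
    i = (fromℕ len) ⁻¹
    A = q * i
    Z = q * A

    cross : ∑ a len (λ k → A * g k + A * g k) ≈ Z + Z
    cross = begin
      ∑ a len (λ k → A * g k + A * g k)   ≈⟨ ∑-+ _ _ a len ⟩
      ∑ a len (λ k → A * g k) + ∑ a len (λ k → A * g k)
        ≈⟨ +-cong (∑-*ˡ A g a len) (∑-*ˡ A g a len) ⟩
      A * q + A * q                       ≈⟨ +-cong (*-comm A q) (*-comm A q) ⟩
      Z + Z                               ∎

    squares : ∑ a len (λ k → A * A + g k * g k) ≈ X + Z
    squares = begin
      ∑ a len (λ k → A * A + g k * g k)   ≈⟨ ∑-+ _ _ a len ⟩
      ∑ a len (λ _ → A * A) + X           ≈⟨ +-congʳ (∑-const (A * A) a len) ⟩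
      fromℕ len * (A * A) + X
        ≈⟨ +-congʳ (×-solve 3 (λ m i q → m · ((q · i) · (q · i)) ⊜ (m · i) · (q · (q · i)))
                              refl (fromℕ len) i q) ⟩
      (fromℕ len * i) * Z + X             ≈⟨ +-congʳ (trans (*-congʳ (⁻¹-inverse _ (fromℕ-suc≉0 n))) (*-identityˡ Z)) ⟩
      Z + X                               ≈⟨ +-comm Z X ⟩
      X + Z                               ∎

    Z≤X : Z ≤ X
    Z≤X = +-cancelʳ-≤ (≤-resp-≈ cross squares (∑-mono _ _ a len (λ k → 2xy≤x²+y² A (g k))))

module PeriodicSums {c ℓ ℓ'} (R : RealField c ℓ ℓ') (M : ℕ) where
  open RealField R
  open IntervalSums R
  open import Relation.Binary.Reasoning.Setoid setoid

  Periodic : (ℤ → Carrier) → Set ℓ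
  Periodic g = ∀ k → g (k ℤ.+ + M) ≈ g k

  Σₚ : (ℤ → Carrier) → Carrier
  Σₚ g = ∑ (+ 0) M g

  Σₚ-cong : ∀ {g h : ℤ → Carrier} → (∀ k → g k ≈ h k) → Σₚ g ≈ Σₚ h
  Σₚ-cong = ∑-cong (+ 0) M

  Σₚ-+ : ∀ (g h : ℤ → Carrier) → Σₚ (λ k → g k + h k) ≈ Σₚ g + Σₚ h
  Σₚ-+ g h = ∑-+ g h (+ 0) M

  translate-periodic : ∀ {g} → Periodic g → ∀ u → Periodic (λ k → g (k ℤ.+ u))
  translate-periodic {g} g-per u k = trans (cong≈ g (swap k (+ M) u)) (g-per (k ℤ.+ u))
    where
    swap : ∀ k m u → (k ℤ.+ m) ℤ.+ u Eq.≡ (k ℤ.+ u) ℤ.+ m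
    swap = solve-∀

  *-periodic : ∀ {g h} → Periodic g → Periodic h → Periodic (λ k → g k * h k)
  *-periodic g-per h-per k = *-cong (g-per k) (h-per k)

  Σₚ-translate : ∀ {g} → Periodic g → ∀ u → Σₚ (λ k → g (k ℤ.+ u)) ≈ Σₚ g
  Σₚ-translate {g} g-per u = begin
    ∑ (+ 0) M (λ k → g (k ℤ.+ u))  ≈⟨ Σₚ-cong (λ k → cong≈ g (ℤP.+-comm k u)) ⟩
    ∑ (+ 0) M (λ k → g (u ℤ.+ k))  ≈⟨ ∑-translate g u (+ 0) M ⟩
    ∑ (u ℤ.+ + 0) M g              ≈⟨ ∑-window-start M g g-per _ ⟩
    ∑ (+ 0) M g                    ∎

module Windows {c ℓ ℓ'} (R : RealField c ℓ ℓ') (M : ℕ) (f : ℤ → RealField.Carrier R)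
               (f-periodic : PeriodicSums.Periodic R M f) where
  open RealField R
  open IntervalSums R
  open PeriodicSums R M
  open import Relation.Binary.Reasoning.Setoid setoid
  open import Tactic.RingSolver.NonReflective (ACR.fromCommutativeRing commRing (λ _ → nothing))
    using (solve; _⊕_; _⊗_)

  window : ℕ → ℤ → Carrier
  window t k = ∑ k t f

  window² : ℕ → ℤ → Carrier
  window² t k = window t k * window t k

  window-periodic : ∀ t → Periodic (window t)
  window-periodic zero    k = refl
  window-periodic (suc t) k =
    +-cong (f-periodic k) (trans (∑-cong-start t f (swap k (+ M))) (window-periodic t (k ℤ.+ + 1)))
    where
    swap : ∀ k m → (k ℤ.+ m) ℤ.+ + 1 Eq.≡ (k ℤ.+ + 1) ℤ.+ m
    swap = solve-∀

  -- Each value of f lies in exactly t windows of length t.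
  Σₚ-window : ∀ t → Σₚ (window t) ≈ fromℕ t * Σₚ f
  Σₚ-window zero    = trans (∑-const 0# (+ 0) M) (trans (zeroʳ _) (sym (zeroˡ (Σₚ f))))
  Σₚ-window (suc t) = begin
    Σₚ (λ k → f k + window t (k ℤ.+ + 1))   ≈⟨ Σₚ-+ f _ ⟩
    Σₚ f + Σₚ (λ k → window t (k ℤ.+ + 1))  ≈⟨ +-congˡ (Σₚ-translate (window-periodic t) (+ 1)) ⟩
    Σₚ f + Σₚ (window t)                    ≈⟨ +-cong (sym (*-identityˡ (Σₚ f))) (Σₚ-window t) ⟩
    1# * Σₚ f + fromℕ t * Σₚ f              ≈⟨ sym (distribʳ (Σₚ f) 1# (fromℕ t)) ⟩
    (1# + fromℕ t) * Σₚ f                   ∎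

  correlation : ℕ → ℤ → Carrier
  correlation s k = ∑ (ℤ.- (+ s) ℤ.+ + 1) (s ℕ.+ s ℕ.∸ 1) (λ l → f k * f (k ℤ.+ l))

  correlation-split : ∀ t k →
    correlation (suc t) k ≈ f k * window t (k ℤ.+ ℤ.- (+ t)) + (f k * f k + f k * window t (k ℤ.+ + 1))
  correlation-split t k = begin
    correlation (suc t) k
      ≈⟨ ∑-split g lowest t (suc t) ⟩
    ∑ lowest t g + ∑ (lowest ℤ.+ + t) (suc t) g
      ≈⟨ +-cong (∑-cong-start t g (lowest≡-t (+ t))) (∑-cong-start (suc t) g (middle≡0 (+ t))) ⟩
    ∑ (ℤ.- (+ t)) t g + (f k * f (k ℤ.+ + 0) + ∑ (+ 1) t g)
      ≈⟨ +-cong (as-window (ℤ.- (+ t))) (+-cong (*-congˡ (cong≈ f (ℤP.+-identityʳ k))) (as-window (+ 1))) ⟩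
    f k * window t (k ℤ.+ ℤ.- (+ t)) + (f k * f k + f k * window t (k ℤ.+ + 1)) ∎
    where
    lowest = ℤ.- (+ suc t) ℤ.+ + 1
    g = λ l → f k * f (k ℤ.+ l)
    lowest≡-t : ∀ x → ℤ.- (+ 1 ℤ.+ x) ℤ.+ + 1 Eq.≡ ℤ.- x
    lowest≡-t = solve-∀
    middle≡0 : ∀ x → (ℤ.- (+ 1 ℤ.+ x) ℤ.+ + 1) ℤ.+ x Eq.≡ + 0
    middle≡0 = solve-∀
    as-window : ∀ a → ∑ a t g ≈ f k * window t (k ℤ.+ a)
    as-window a = trans (∑-*ˡ (f k) _ a t) (*-congˡ (∑-translate f k a t))

  -- Lag -(t+1) and lag t+1 contribute equally over a period (substitute k ↦ k + t + 1).
  lag-reflection : ∀ t → Σₚ (λ k → f k * f (k ℤ.+ ℤ.- (+ suc t))) ≈ Σₚ (λ k → f k * f ((k ℤ.+ + 1) ℤ.+ + t))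
  lag-reflection t = begin
    Σₚ (λ k → f k * f (k ℤ.+ ℤ.- u))
      ≈⟨ sym (Σₚ-translate (*-periodic f-periodic (translate-periodic f-periodic (ℤ.- u))) u) ⟩
    Σₚ (λ k → f (k ℤ.+ u) * f ((k ℤ.+ u) ℤ.+ ℤ.- u))
      ≈⟨ Σₚ-cong (λ k → trans (*-congˡ (cong≈ f (cancel k u))) (*-comm _ _)) ⟩
    Σₚ (λ k → f k * f (k ℤ.+ u))
      ≈⟨ Σₚ-cong (λ k → *-congˡ (cong≈ f (Eq.sym (ℤP.+-assoc k (+ 1) (+ t))))) ⟩
    Σₚ (λ k → f k * f ((k ℤ.+ + 1) ℤ.+ + t)) ∎
    where
    u = + suc t
    cancel : ∀ k u → (k ℤ.+ u) ℤ.+ ℤ.- u Eq.≡ k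
    cancel = solve-∀

  backward≈forward : ∀ t → Σₚ (λ k → f k * window t (k ℤ.+ ℤ.- (+ t))) ≈ Σₚ (λ k → f k * window t (k ℤ.+ + 1))
  backward≈forward zero    = refl
  backward≈forward (suc t) = begin
    Σₚ (λ k → f k * window (suc t) (k ℤ.+ ℤ.- (+ suc t)))
      ≈⟨ Σₚ-cong (λ k → trans (*-congˡ (+-congˡ (∑-cong-start t f (step-back k (+ t))))) (distribˡ _ _ _)) ⟩
    Σₚ (λ k → f k * f (k ℤ.+ ℤ.- (+ suc t)) + f k * window t (k ℤ.+ ℤ.- (+ t)))
      ≈⟨ Σₚ-+ _ _ ⟩
    Σₚ (λ k → f k * f (k ℤ.+ ℤ.- (+ suc t))) + Σₚ (λ k → f k * window t (k ℤ.+ ℤ.- (+ t)))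
      ≈⟨ +-cong (lag-reflection t) (backward≈forward t) ⟩
    Σₚ (λ k → f k * f ((k ℤ.+ + 1) ℤ.+ + t)) + Σₚ (λ k → f k * window t (k ℤ.+ + 1))
      ≈⟨ trans (+-comm _ _) (sym (Σₚ-+ _ _)) ⟩
    Σₚ (λ k → f k * window t (k ℤ.+ + 1) + f k * f ((k ℤ.+ + 1) ℤ.+ + t))
      ≈⟨ Σₚ-cong (λ k → trans (sym (distribˡ _ _ _)) (*-congˡ (sym (∑-snoc f (k ℤ.+ + 1) t)))) ⟩
    Σₚ (λ k → f k * window (suc t) (k ℤ.+ + 1)) ∎
    where
    step-back : ∀ k x → (k ℤ.+ ℤ.- (+ 1 ℤ.+ x)) ℤ.+ + 1 Eq.≡ k ℤ.+ ℤ.- x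
    step-back = solve-∀

  -- Lengthening the window by one raises the energy by exactly Σₚ C_{t+1}:
  -- W_{t+1}(k)² = f k² + 2 f k W_t(k+1) + W_t(k+1)², and Σₚ C_{t+1} is
  -- Σₚ f k W_t(k-t) + Σₚ f k² + Σₚ f k W_t(k+1).
  energy-increment : ∀ t → Σₚ (window² (suc t)) ≈ Σₚ (window² t) + Σₚ (correlation (suc t))
  energy-increment t = begin
    Σₚ (window² (suc t))
      ≈⟨ Σₚ-cong (λ k → solve 2 (λ a b → (a ⊕ b) ⊗ (a ⊕ b) , (a ⊗ a ⊕ (a ⊗ b ⊕ a ⊗ b)) ⊕ b ⊗ b)
                               refl (f k) (window t (k ℤ.+ + 1))) ⟩
    Σₚ (λ k → (f k * f k + (fW k + fW k)) + window² t (k ℤ.+ + 1))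
      ≈⟨ trans (Σₚ-+ _ _) (+-congʳ (trans (Σₚ-+ _ _) (+-congˡ (Σₚ-+ _ _)))) ⟩
    (F + (P + P)) + Σₚ (λ k → window² t (k ℤ.+ + 1))
      ≈⟨ +-congˡ (Σₚ-translate (*-periodic (window-periodic t) (window-periodic t)) (+ 1)) ⟩
    (F + (P + P)) + X
      ≈⟨ solve 3 (λ f p x → (f ⊕ (p ⊕ p)) ⊕ x , x ⊕ (p ⊕ (f ⊕ p))) refl F P X ⟩
    X + (P + (F + P))
      ≈⟨ +-congˡ (+-congʳ (sym (backward≈forward t))) ⟩
    X + (Σₚ (λ k → f k * window t (k ℤ.+ ℤ.- (+ t))) + (F + P))
      ≈⟨ +-congˡ (sym (trans (Σₚ-+ _ _) (+-congˡ (Σₚ-+ _ _)))) ⟩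
    X + Σₚ (λ k → f k * window t (k ℤ.+ ℤ.- (+ t)) + (f k * f k + fW k))
      ≈⟨ +-congˡ (Σₚ-cong (λ k → sym (correlation-split t k))) ⟩
    X + Σₚ (correlation (suc t)) ∎
    where
    fW = λ k → f k * window t (k ℤ.+ + 1)
    F = Σₚ (λ k → f k * f k)
    P = Σₚ fW
    X = Σₚ (window² t)

  energy-identity : ∀ t → sumFrom1 t (λ s → Σₚ (correlation s)) ≈ Σₚ (window² t)
  energy-identity zero    = sym (trans (∑-const (0# * 0#) (+ 0) M) (trans (*-congˡ (zeroˡ 0#)) (zeroʳ _)))
  energy-identity (suc t) = trans (+-congʳ (energy-identity t)) (sym (energy-increment t))

module PeriodicExtension {c ℓ ℓ'} (R : RealField c ℓ ℓ') (M : ℕ) .{{_ : NonZero M}}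
                         (y : Fin M → RealField.Carrier R) where
  open RealField R
  open IntervalSums R
  open PeriodicSums R M
  open Data.Fin using (toℕ)

  yper-periodic : Periodic (yper M y)
  yper-periodic k = reflexive (Eq.cong (λ r → y (r mod M)) (IntegerResidues.%ℕ-periodic k M))

  yper-toℕ : ∀ m → yper M y (+ toℕ m) ≈ y m
  yper-toℕ m = reflexive (Eq.cong y (FinP.toℕ-injective (begin
    toℕ ((toℕ m ℕ.% M) mod M) ≡⟨ FinP.toℕ-fromℕ< _ ⟩
    toℕ m ℕ.% M ℕ.% M         ≡⟨ m%n%n≡m%n (toℕ m) M ⟩
    toℕ m ℕ.% M               ≡⟨ m<n⇒m%n≡m (FinP.toℕ<n m) ⟩
    toℕ m                     ∎)))
    where open Eq.≡-Reasoning

  open Windows R M (yper M y) yper-periodic using (correlation)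

  sumFin-as-Σₚ : sumFin M y ≈ Σₚ (yper M y)
  sumFin-as-Σₚ = trans (sumFin-cong M (λ m → sym (yper-toℕ m))) (sumFin-as-∑ (yper M y) (+ 0) M)

  H-as-correlation : ∀ s → H M y s ≈ Σₚ (correlation s)
  H-as-correlation s =
    trans (sumFin-cong M (λ m → ∑-cong {g = λ l → y m * yper M y (+ toℕ m ℤ.+ l)} (ℤ.- (+ s) ℤ.+ + 1) (s ℕ.+ s ℕ.∸ 1)
                                  (λ l → *-congʳ (sym (yper-toℕ m)))))
          (sumFin-as-∑ (correlation s) (+ 0) M)

lemma1 : ∀ {c ℓ ℓ'} (R : RealField c ℓ ℓ') → let open RealField R in
    ∀ (M : ℕ) .{{_ : NonZero M}} (y : Fin M → Carrier) (N : Carrier) →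
    (∀ m → 0# ≤ y m) → sumFin M y ≈ N →
    ∀ (S : ℕ) → 1 ℕ.≤ S → S ℕ.+ S ℕ.< M →
    (((fromℕ S * N) * N) * (fromℕ M ⁻¹)) ≤ ((fromℕ S ⁻¹) * sumFrom1 S (H M y))
lemma1 R M y N _ _ zero () _
lemma1 R zero y N _ _ (suc S) _ ()
lemma1 R M@(suc M-1) y N _ Σy≈N S@(suc S-1) _ _ =
  ≤-resp-≈ rearrange (*-congˡ (sym energy)) (*-monoˡ-≤ (⁻¹-nonneg _ (fromℕ-suc≉0 S-1) (fromℕ-nonneg S)) mean-bound)
  where
  open RealField R
  open OrderedFieldFacts R using (*-monoˡ-≤; ⁻¹-nonneg; fromℕ-suc≉0; fromℕ-nonneg)
  open IntervalSums R using (∑-square-mean; sumFrom1-cong)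
  open PeriodicSums R M using (Σₚ)
  open PeriodicExtension R M y using (yper-periodic; sumFin-as-Σₚ; H-as-correlation)
  open Windows R M (yper M y) yper-periodic using (window; window²; Σₚ-window; energy-identity)
  open CommutativeMonoidSolver *-commutativeMonoid using (_⊜_) renaming (solve to ×-solve; _⊕_ to _·_)

  energy : sumFrom1 S (H M y) ≈ Σₚ (window² S)
  energy = trans (sumFrom1-cong S H-as-correlation) (energy-identity S)

  window-total : Σₚ (window S) ≈ fromℕ S * N
  window-total = trans (Σₚ-window S) (*-congˡ (trans (sym sumFin-as-Σₚ) Σy≈N))

  mean-bound : (((fromℕ S * N) * (fromℕ S * N)) * (fromℕ M ⁻¹)) ≤ Σₚ (window² S)
  mean-bound = ≤-resp-≈ (*-congʳ (*-cong window-total window-total)) refl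
                        (∑-square-mean (window S) (+ 0) M-1)

  -- S⁻¹·(SN)²·M⁻¹ = (S·S⁻¹)·(SN·N·M⁻¹) = SN·N·M⁻¹
  rearrange : (fromℕ S ⁻¹) * (((fromℕ S * N) * (fromℕ S * N)) * (fromℕ M ⁻¹)) ≈ ((fromℕ S * N) * N) * (fromℕ M ⁻¹)
  rearrange = trans (×-solve 4 (λ j s n i → j · (((s · n) · (s · n)) · i) ⊜ (s · j) · (((s · n) · n) · i))
                             refl (fromℕ S ⁻¹) (fromℕ S) N (fromℕ M ⁻¹))
                    (trans (*-congʳ (⁻¹-inverse _ (fromℕ-suc≉0 S-1))) (*-identityˡ _))
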